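{- For all primes $p\geq 5$, \[ \sum_{k=1}^{p-1}k^2H_k(1)^2\equiv -\frac49+\frac{79}{108}p-\frac{13}{36}p^2+\frac16H_{p-1}(1)\pmod{p^3}. \]
   Context: $H_N(1)=\sum_{n=1}^N\frac1n$ is the $N$-th harmonic number. For rationals $x,y$, $x\equiv y\pmod{p^3}$ means the numerator of $x-y$ is divisible by $p^3$. -}

module Defs where

open import Data.Nat as ℕ using (ℕ; zero; suc)
open import Data.Integer as ℤ using (ℤ; +_)
open import Data.Integer.Divisibility using (_∣_)
open import Data.Rational using (ℚ; _/_; _+_; _-_; _*_; ↥_; 0ℚ)

H : ℕ → ℚ
H zero    = 0ℚ
H (suc n) = H n + ((+ 1) / suc n)

Σ₁ : ℕ → (ℕ → ℚ) → ℚ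
Σ₁ zero    f = 0ℚ
Σ₁ (suc n) f = Σ₁ n f + f (suc n)

ι : ℕ → ℚ
ι k = (+ k) / 1

_≡_[modℚ_] : ℚ → ℚ → ℕ → Set
x ≡ y [modℚ m ] = (+ m) ∣ (↥ (x - y))

-- Write p = n + 1, F = n! and N = F·Hₙ = Σ_{k≤n} n!/k. By induction the sum has the closed form
-- 108 Σ_{k≤n} k²H_k² = 18n(n+1)(2n+1)Hₙ² + b(n)Hₙ + c(n) with cubic b, c, and a polynomial identity
-- turns 108F²·(sum − right-hand side) into p³·G(n, N/p², F) with G an integer polynomial. So the
-- congruence holds once p² ∣ N (Wolstenholme's theorem), because p ∤ 108F².
-- For Wolstenholme, pairing k with p − k gives 2N = p·Σ W_k where k(p − k)W_k = F. Modulo p,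
-- W_k ≡ −F·k̄² for the inverse k̄ of k, and k ↦ k̄ permutes 1, …, p − 1, so
-- Σ W_k ≡ −F·Σ k² = −F(p − 1)p(2p − 1)/6 ≡ 0 as p > 3.
module Submission where

open import Defs
open import Data.Integer.Base using (ℤ)

module PrimeDivisors where
  open import Data.Nat.Base
  open import Data.Nat.Properties
  open import Data.Nat.Divisibility
  open import Data.Nat.Primality using (Prime; euclidsLemma; prime⇒nonTrivial; prime⇒nonZero)
  open import Data.Sum using (inj₁; inj₂)
  open import Relation.Nullary using (¬_; contradiction)
  open import Relation.Binary.PropositionalEquality

  module _ {p : ℕ} (p-prime : Prime p) where
    instance
      _ : NonZero p
      _ = prime⇒nonZero p-prime

    ∤-* : ∀ {m n} → ¬ p ∣ m → ¬ p ∣ n → ¬ p ∣ m * n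
    ∤-* {m} {n} p∤m p∤n p∣mn with euclidsLemma m n p-prime p∣mn
    ... | inj₁ p∣m = p∤m p∣m
    ... | inj₂ p∣n = p∤n p∣n

    <⇒∤ : ∀ {m} .{{_ : NonZero m}} → m < p → ¬ p ∣ m
    <⇒∤ m<p p∣m = <⇒≱ m<p (∣⇒≤ p∣m)

    <⇒∤! : ∀ {m} → m < p → ¬ p ∣ m !
    <⇒∤! {zero}  _   = <⇒∤ (nonTrivial⇒n>1 p {{prime⇒nonTrivial p-prime}})
    <⇒∤! {suc m} m<p = ∤-* (<⇒∤ m<p) (<⇒∤! (<-trans (n<1+n m) m<p))

    ∤2 : 5 ≤ p → ¬ p ∣ 2
    ∤2 5≤p = <⇒∤ (≤-trans (s≤s (s≤s (s≤s z≤n))) 5≤p)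

    ∤3 : 5 ≤ p → ¬ p ∣ 3
    ∤3 5≤p = <⇒∤ (≤-trans (s≤s (s≤s (s≤s (s≤s z≤n)))) 5≤p)

    ^∣-cancelʳ : ∀ {m n} → ¬ p ∣ n → ∀ e → p ^ e ∣ m * n → p ^ e ∣ m
    ^∣-cancelʳ {m} _ zero _ = 1∣ m
    ^∣-cancelʳ {m} {n} p∤n (suc e) pᵉ⁺¹∣mn with euclidsLemma m n p-prime (∣-trans (m∣m*n (p ^ e)) pᵉ⁺¹∣mn)
    ... | inj₂ p∣n = contradiction p∣n p∤n
    ... | inj₁ (divides c refl) = subst (p ^ suc e ∣_) (*-comm p c) (*-monoʳ-∣ p pᵉ∣c)
      where
      pᵉ⁺¹∣p*[c*n] : p * p ^ e ∣ p * (c * n)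
      pᵉ⁺¹∣p*[c*n] = subst (p ^ suc e ∣_) (trans (cong (_* n) (*-comm c p)) (*-assoc p c n)) pᵉ⁺¹∣mn
      pᵉ∣c : p ^ e ∣ c
      pᵉ∣c = ^∣-cancelʳ p∤n e (*-cancelˡ-∣ p pᵉ⁺¹∣p*[c*n])

module ModularInverse where
  open import Data.Nat.Base
  open import Data.Nat.Properties
  open import Data.Nat.DivMod
  open import Data.Nat.Primality using (Prime; prime⇒nonZero; prime⇒nonTrivial)
  open import Data.Nat.Coprimality using (prime⇒coprime; coprime-Bézout)
  open import Data.Nat.GCD using (module Bézout)
  open import Data.Nat.Tactic.RingSolver using (solve)
  open import Data.List.Base using ([]; _∷_)
  open import Data.Product using (∃-syntax; _×_; _,_)
  open import Relation.Binary.PropositionalEquality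
  open ≡-Reasoning

  module _ {d : ℕ} .{{_ : NonZero d}} where

    m*[n%d]%d≡m*n%d : ∀ m n → m * (n % d) % d ≡ m * n % d
    m*[n%d]%d≡m*n%d m n = begin
      m * (n % d) % d           ≡⟨ %-distribˡ-* m (n % d) d ⟩
      m % d * (n % d % d) % d   ≡⟨ cong (λ x → m % d * x % d) (m%n%n≡m%n n d) ⟩
      m % d * (n % d) % d       ≡⟨ %-distribˡ-* m n d ⟨
      m * n % d                 ∎

    n%d≡1⇒m*n%d≡m%d : ∀ m {n} → n % d ≡ 1 → m * n % d ≡ m % d
    n%d≡1⇒m*n%d≡m%d m {n} n%d≡1 = begin
      m * n % d          ≡⟨ m*[n%d]%d≡m*n%d m n ⟨
      m * (n % d) % d    ≡⟨ cong (λ x → m * x % d) n%d≡1 ⟩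
      m * 1 % d          ≡⟨ cong (_% d) (*-identityʳ m) ⟩
      m % d              ∎

    inverse-unique : ∀ a b c → a * b % d ≡ 1 → b * c % d ≡ 1 → a % d ≡ c % d
    inverse-unique a b c ab≡1 bc≡1 = begin
      a % d            ≡⟨ n%d≡1⇒m*n%d≡m%d a bc≡1 ⟨
      a * (b * c) % d  ≡⟨ cong (_% d) (*-assoc a b c) ⟨
      a * b * c % d    ≡⟨ cong (_% d) (*-comm (a * b) c) ⟩
      c * (a * b) % d  ≡⟨ n%d≡1⇒m*n%d≡m%d c ab≡1 ⟩
      c % d            ∎

  module _ {p : ℕ} (p-prime : Prime p) where
    instance
      _ : NonZero p
      _ = prime⇒nonZero p-prime

    1%p≡1 : 1 % p ≡ 1
    1%p≡1 = m<n⇒m%n≡m (nonTrivial⇒n>1 p {{prime⇒nonTrivial p-prime}})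

    inverse-exists : ∀ {k} .{{_ : NonZero k}} → k < p → ∃[ k′ ] k * k′ % p ≡ 1
    inverse-exists {k} k<p with coprime-Bézout (prime⇒coprime p-prime k<p)
    ... | Bézout.-+ x y 1+xp≡yk = y , (begin
      k * y % p        ≡⟨ cong (_% p) (trans (*-comm k y) (sym 1+xp≡yk)) ⟩
      (1 + x * p) % p  ≡⟨ [m+kn]%n≡m%n 1 x p ⟩
      1 % p            ≡⟨ 1%p≡1 ⟩
      1                ∎)
    -- Here k·y ≡ −1, so y·(p − 1) is an inverse: k·y(p − 1) + p = 1 + (p − 1)x·p.
    ... | Bézout.+- x y 1+yk≡xp = y * pred p , (begin
      k * (y * pred p) % p        ≡⟨ [m+n]%n≡m%n (k * (y * pred p)) p ⟨
      (k * (y * pred p) + p) % p  ≡⟨ cong (_% p) (k*[y*q]+p≡1+q*x*p (pred p) (sym (suc-pred p))) ⟩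
      (1 + pred p * x * p) % p    ≡⟨ [m+kn]%n≡m%n 1 (pred p * x) p ⟩
      1 % p                       ≡⟨ 1%p≡1 ⟩
      1                           ∎)
      where
      k*[y*q]+p≡1+q*x*p : ∀ q → p ≡ suc q → k * (y * q) + p ≡ 1 + q * x * p
      k*[y*q]+p≡1+q*x*p q refl = begin
        k * (y * q) + suc q  ≡⟨ solve (k ∷ y ∷ q ∷ []) ⟩
        1 + q * (1 + y * k)  ≡⟨ cong (λ t → 1 + q * t) 1+yk≡xp ⟩
        1 + q * (x * p)      ≡⟨ cong (1 +_) (*-assoc q x p) ⟨
        1 + q * x * p        ∎

    reduced-inverse-exists : ∀ {k} .{{_ : NonZero k}} → k < p → ∃[ r ] r < p × k * r % p ≡ 1
    reduced-inverse-exists {k} k<p with inverse-exists k<p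
    ... | k′ , kk′≡1 = k′ % p , m%n<n k′ p , trans (m*[n%d]%d≡m*n%d {p} k k′) kk′≡1

module FinSums where
  open import Data.Nat.Base
  open import Data.Nat.Properties
  open import Data.Nat.Tactic.RingSolver using (solve)
  open import Data.List.Base using ([]; _∷_)
  open import Data.Fin.Base using (Fin; toℕ; inject₁; fromℕ)
  open import Data.Fin.Properties using (toℕ-inject₁; toℕ-fromℕ)
  open import Data.Fin.Permutation using (permutation)
  open import Function using (_∘_)
  open import Relation.Binary.PropositionalEquality
  open ≡-Reasoning
  open import Algebra.Properties.Semiring.Sum +-*-semiring public

  sum-involution : ∀ {n} (f : Fin n → ℕ) (g : Fin n → Fin n) → (∀ i → g (g i) ≡ i) → sum f ≡ sum (f ∘ g)
  sum-involution f g g∘g≗id = sum-permute f (permutation g g g∘g≗id g∘g≗id)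

  sum-toℕ-snoc : ∀ n (g : ℕ → ℕ) → ∑[ i < suc n ] g (toℕ i) ≡ ∑[ i < n ] g (toℕ i) + g n
  sum-toℕ-snoc n g = begin
    ∑[ i < suc n ] g (toℕ i)                             ≡⟨ sum-init-last {n} (g ∘ toℕ) ⟩
    ∑[ i < n ] g (toℕ (inject₁ i)) + g (toℕ (fromℕ n))
      ≡⟨ cong₂ _+_ (sum-cong-≗ {n} (cong g ∘ toℕ-inject₁)) (cong g (toℕ-fromℕ n)) ⟩
    ∑[ i < n ] g (toℕ i) + g n                           ∎

  6*∑squares : ∀ n → 6 * ∑[ i < n ] (suc (toℕ i) * suc (toℕ i)) ≡ n * suc n * (2 * n + 1)
  6*∑squares zero    = refl
  6*∑squares (suc n) = begin
    6 * ∑[ i < suc n ] (suc (toℕ i) * suc (toℕ i))      ≡⟨ cong (6 *_) (sum-toℕ-snoc n (λ k → suc k * suc k)) ⟩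
    6 * (S + suc n * suc n)                              ≡⟨ *-distribˡ-+ 6 S (suc n * suc n) ⟩
    6 * S + 6 * (suc n * suc n)                          ≡⟨ cong (_+ 6 * (suc n * suc n)) (6*∑squares n) ⟩
    n * suc n * (2 * n + 1) + 6 * (suc n * suc n)        ≡⟨ solve (n ∷ []) ⟩
    suc n * suc (suc n) * (2 * suc n + 1)                ∎
    where
    S = ∑[ i < n ] (suc (toℕ i) * suc (toℕ i))

module Wolstenholme where
  open import Data.Nat.Base
  open import Data.Nat.Properties
  open import Data.Nat.Divisibility
  open import Data.Nat.DivMod using (_/_; _%_; m*[n/m]≡n; m≡m%n+[m/n]*n; m<n⇒m%n≡m)
  open import Data.Nat.Primality using (Prime; euclidsLemma; prime⇒nonZero)
  open import Data.Nat.Tactic.RingSolver using (solve)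
  open import Data.List.Base using ([]; _∷_)
  open import Data.Fin.Base using (Fin; toℕ; fromℕ<; opposite)
  open import Data.Fin.Properties using (toℕ<n; toℕ-fromℕ<; toℕ-injective; opposite-prop; opposite-involutive)
  open import Data.Product using (∃-syntax; _×_; _,_; proj₁; proj₂)
  open import Data.Sum using (_⊎_; inj₁; inj₂)
  open import Function using (_∘_)
  open import Relation.Nullary using (¬_; contradiction)
  open import Relation.Binary.PropositionalEquality
  open ≡-Reasoning
  open PrimeDivisors
  open ModularInverse
  open FinSums

  harmonicNumerator : ℕ → ℕ
  harmonicNumerator n = ∑[ i < n ] (n ! / suc (toℕ i))

  k*l*[u+v]≡F*[k+l] : ∀ {k l u v F} → k * u ≡ F → l * v ≡ F → k * l * (u + v) ≡ F * (k + l)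
  k*l*[u+v]≡F*[k+l] {k} {l} {u} {v} refl lv≡ku = begin
    k * l * (u + v)              ≡⟨ solve (k ∷ l ∷ u ∷ v ∷ []) ⟩
    l * (k * u) + k * (l * v)    ≡⟨ cong (λ x → l * (k * u) + k * x) lv≡ku ⟩
    l * (k * u) + k * (k * u)    ≡⟨ solve (k ∷ l ∷ u ∷ []) ⟩
    k * u * (k + l)              ∎

  -- The exact form of W ≡ −F·k′² (mod p).
  paired-term : ∀ {p k l k′ α w F} → k + l ≡ p → k * l * w ≡ F → k * k′ ≡ 1 + α * p →
                w + F * (k′ * k′) + p * (w * α * (2 + p * α)) ≡ p * (k * w * (k′ * k′))
  paired-term {k = k} {l} {k′} {α} {w} refl refl kk′≡1+αp = begin
    w + k * l * w * (k′ * k′) + (k + l) * (w * α * (2 + (k + l) * α))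
      ≡⟨ solve (k ∷ l ∷ k′ ∷ α ∷ w ∷ []) ⟩
    w * ((1 + α * (k + l)) * (1 + α * (k + l))) + k * l * w * (k′ * k′)
      ≡⟨ cong (λ x → w * (x * x) + k * l * w * (k′ * k′)) kk′≡1+αp ⟨
    w * ((k * k′) * (k * k′)) + k * l * w * (k′ * k′)
      ≡⟨ solve (k ∷ l ∷ k′ ∷ w ∷ []) ⟩
    (k + l) * (k * w * (k′ * k′))                                       ∎

  wolstenholme-identity : ∀ {p n N F w s d g} → N + N ≡ w * p → 6 * s ≡ n * p * (2 * n + 1) →
                          w + F * s + p * d ≡ p * g →
                          p * p * (F * (n * (2 * n + 1)) + 6 * d) + N * 12 ≡ 6 * g * (p * p)
  wolstenholme-identity {p} {n} {N} {F} {w} {s} {d} {g} 2N≡wp 6s≡np[2n+1] w+Fs+pd≡pg = begin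
    p * p * (F * (n * (2 * n + 1)) + 6 * d) + N * 12                ≡⟨ solve (p ∷ n ∷ N ∷ F ∷ d ∷ []) ⟩
    (N + N) * 6 + p * F * (n * p * (2 * n + 1)) + 6 * p * (p * d)
      ≡⟨ cong₂ (λ x y → x * 6 + p * F * y + 6 * p * (p * d)) 2N≡wp (sym 6s≡np[2n+1]) ⟩
    w * p * 6 + p * F * (6 * s) + 6 * p * (p * d)                   ≡⟨ solve (p ∷ F ∷ w ∷ s ∷ d ∷ []) ⟩
    6 * p * (w + F * s + p * d)                                     ≡⟨ cong (6 * p *_) w+Fs+pd≡pg ⟩
    6 * p * (p * g)                                                 ≡⟨ solve (p ∷ g ∷ []) ⟩
    6 * g * (p * p)                                                 ∎

  module _ (n : ℕ) (p-prime : Prime (suc n)) where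
    private
      p F : ℕ
      p = suc n
      F = n !

      K U : Fin n → ℕ
      K i = suc (toℕ i)
      U i = F / K i

    K<p : ∀ i → K i < p
    K<p i = s≤s (toℕ<n i)

    K*U≡F : ∀ i → K i * U i ≡ F
    K*U≡F i = m*[n/m]≡n (∣-trans (m∣m*n (toℕ i !)) (m≤n⇒m!∣n! (toℕ<n i)))

    K+K∘opposite≡p : ∀ i → K i + K (opposite i) ≡ p
    K+K∘opposite≡p i = begin
      suc (toℕ i) + suc (toℕ (opposite i))   ≡⟨ cong (λ t → suc (toℕ i) + suc t) (opposite-prop i) ⟩
      suc (toℕ i) + suc (n ∸ suc (toℕ i))    ≡⟨ +-suc (suc (toℕ i)) _ ⟩
      suc (suc (toℕ i) + (n ∸ suc (toℕ i)))  ≡⟨ cong suc (m+[n∸m]≡n (toℕ<n i)) ⟩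
      p                                      ∎

    pairing : ∀ i → ∃[ w ] U i + U (opposite i) ≡ w * p × K i * K (opposite i) * w ≡ F
    pairing i = cofactor (euclidsLemma (k * l) (U i + U (opposite i)) p-prime (divides F kl[U+U′]≡Fp))
      where
      instance _ = prime⇒nonZero p-prime
      k = K i
      l = K (opposite i)
      kl[U+U′]≡Fp : k * l * (U i + U (opposite i)) ≡ F * p
      kl[U+U′]≡Fp = trans (k*l*[u+v]≡F*[k+l] (K*U≡F i) (K*U≡F (opposite i))) (cong (F *_) (K+K∘opposite≡p i))
      cofactor : p ∣ k * l ⊎ p ∣ U i + U (opposite i) → ∃[ w ] U i + U (opposite i) ≡ w * p × k * l * w ≡ F
      cofactor (inj₁ p∣kl) = contradiction p∣kl (∤-* p-prime (<⇒∤ p-prime (K<p i)) (<⇒∤ p-prime (K<p (opposite i))))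
      cofactor (inj₂ (divides w s≡wp)) = w , s≡wp , *-cancelʳ-≡ _ F p (begin
        k * l * w * p                    ≡⟨ *-assoc (k * l) w p ⟩
        k * l * (w * p)                  ≡⟨ cong (k * l *_) s≡wp ⟨
        k * l * (U i + U (opposite i))   ≡⟨ kl[U+U′]≡Fp ⟩
        F * p                            ∎)

    inverse : ∀ i → ∃[ j ] K i * K j % p ≡ 1
    inverse i = residue (reduced-inverse-exists p-prime (K<p i))
      where
      residue : ∃[ r ] r < p × K i * r % p ≡ 1 → ∃[ j ] K i * K j % p ≡ 1
      residue (zero  , _       , k*0≡1) = contradiction (trans (cong (_% p) (sym (*-zeroʳ (K i)))) k*0≡1) λ ()
      residue (suc r , s≤s r<n , k*r≡1) = fromℕ< r<n , subst (λ t → K i * suc t % p ≡ 1) (sym (toℕ-fromℕ< r<n)) k*r≡1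

    inv : Fin n → Fin n
    inv i = proj₁ (inverse i)

    K*K∘inv≡1 : ∀ i → K i * K (inv i) % p ≡ 1
    K*K∘inv≡1 i = proj₂ (inverse i)

    inv-involutive : ∀ i → inv (inv i) ≡ i
    inv-involutive i = toℕ-injective (suc-injective (begin
      K (inv (inv i))      ≡⟨ m<n⇒m%n≡m (K<p (inv (inv i))) ⟨
      K (inv (inv i)) % p  ≡⟨ inverse-unique {p} (K i) (K (inv i)) (K (inv (inv i))) (K*K∘inv≡1 i) (K*K∘inv≡1 (inv i)) ⟨
      K i % p              ≡⟨ m<n⇒m%n≡m (K<p i) ⟩
      K i                  ∎))

    α : Fin n → ℕ
    α i = K i * K (inv i) / p

    K*K∘inv≡1+αp : ∀ i → K i * K (inv i) ≡ 1 + α i * p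
    K*K∘inv≡1+αp i = trans (m≡m%n+[m/n]*n (K i * K (inv i)) p) (cong (_+ α i * p) (K*K∘inv≡1 i))

    private
      W Γ Δ : Fin n → ℕ
      W i = proj₁ (pairing i)
      Γ i = K i * W i * (K (inv i) * K (inv i))
      Δ i = W i * α i * (2 + p * α i)

    2N≡∑W*p : harmonicNumerator n + harmonicNumerator n ≡ sum W * p
    2N≡∑W*p = begin
      sum U + sum U                            ≡⟨ cong (sum U +_) (sum-involution U opposite opposite-involutive) ⟩
      sum U + sum (U ∘ opposite)               ≡⟨ ∑-distrib-+ U (U ∘ opposite) ⟨
      ∑[ i < n ] (U i + U (opposite i))        ≡⟨ sum-cong-≗ {n} (proj₁ ∘ proj₂ ∘ pairing) ⟩
      ∑[ i < n ] (W i * p)                     ≡⟨ *-distribʳ-sum p W ⟨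
      sum W * p                                ∎

    ∑W+F∑K²+p∑Δ≡p∑Γ : sum W + F * ∑[ i < n ] (K i * K i) + p * sum Δ ≡ p * sum Γ
    ∑W+F∑K²+p∑Δ≡p∑Γ = begin
      sum W + F * ∑[ i < n ] (K i * K i) + p * sum Δ
        ≡⟨ cong (λ x → sum W + F * x + p * sum Δ) (sum-involution (λ i → K i * K i) inv inv-involutive) ⟩
      sum W + F * sum K∘inv² + p * sum Δ
        ≡⟨ cong₂ (λ x y → sum W + x + y) (*-distribˡ-sum F K∘inv²) (*-distribˡ-sum p Δ) ⟩
      sum W + ∑[ i < n ] (F * K∘inv² i) + ∑[ i < n ] (p * Δ i)
        ≡⟨ cong (_+ ∑[ i < n ] (p * Δ i)) (∑-distrib-+ W (λ i → F * K∘inv² i)) ⟨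
      ∑[ i < n ] (W i + F * K∘inv² i) + ∑[ i < n ] (p * Δ i)
        ≡⟨ ∑-distrib-+ (λ i → W i + F * K∘inv² i) (λ i → p * Δ i) ⟨
      ∑[ i < n ] (W i + F * K∘inv² i + p * Δ i)
        ≡⟨ sum-cong-≗ {n} {λ i → W i + F * K∘inv² i + p * Δ i} {λ i → p * Γ i} paired ⟩
      ∑[ i < n ] (p * Γ i)
        ≡⟨ *-distribˡ-sum p Γ ⟨
      p * sum Γ                                                ∎
      where
      K∘inv² : Fin n → ℕ
      K∘inv² i = K (inv i) * K (inv i)
      paired : ∀ i → W i + F * K∘inv² i + p * Δ i ≡ p * Γ i
      paired i = paired-term {p} {K i} {K (opposite i)} {K (inv i)} {α i} {W i} {F}
                   (K+K∘opposite≡p i) (proj₂ (proj₂ (pairing i))) (K*K∘inv≡1+αp i)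

    p*p∣12N : p * p ∣ harmonicNumerator n * 12
    p*p∣12N = ∣m+n∣m⇒∣n (divides (6 * sum Γ) p²x+12N≡6∑Γp²) (m∣m*n (F * (n * (2 * n + 1)) + 6 * sum Δ))
      where
      p²x+12N≡6∑Γp² = wolstenholme-identity {p} {n} {harmonicNumerator n} {F} {sum W} {∑[ i < n ] (K i * K i)} {sum Δ} {sum Γ}
                        2N≡∑W*p (6*∑squares n) ∑W+F∑K²+p∑Δ≡p∑Γ

  wolstenholme : ∀ n → Prime (suc n) → 5 ≤ suc n → suc n ^ 2 ∣ harmonicNumerator n
  wolstenholme n p-prime 5≤p = ^∣-cancelʳ p-prime p∤12 2 (subst (_∣ harmonicNumerator n * 12) p*p≡p² (p*p∣12N n p-prime))
    where
    p*p≡p² : suc n * suc n ≡ suc n ^ 2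
    p*p≡p² = cong (suc n *_) (sym (*-identityʳ (suc n)))
    p∤12 : ¬ suc n ∣ 2 * (2 * 3)
    p∤12 = ∤-* p-prime (∤2 p-prime 5≤p) (∤-* p-prime (∤2 p-prime 5≤p) (∤3 p-prime 5≤p))

module IntegersInRationals where
  open import Data.Nat.Base as ℕ using (ℕ; suc)
  import Data.Nat.Properties as ℕ
  open import Data.Integer.Base as ℤ using (ℤ; +_)
  import Data.Integer.Properties as ℤ
  open import Data.Integer.Tactic.RingSolver using (solve)
  open import Data.List.Base using ([]; _∷_)
  open import Data.Rational.Base
  open import Data.Rational.Properties
  import Data.Rational.Unnormalised.Base as ℚᵘ
  import Data.Rational.Unnormalised.Properties as ℚᵘ
  open import Relation.Binary.PropositionalEquality
  open ℚᵘ.≃-Reasoning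

  fromℤ : ℤ → ℚ
  fromℤ z = z / 1

  private
    toℚᵘ-fromℤ : ∀ z → toℚᵘ (fromℤ z) ℚᵘ.≃ ℚᵘ.mkℚᵘ z 0
    toℚᵘ-fromℤ z = toℚᵘ-fromℚᵘ (ℚᵘ.mkℚᵘ z 0)

  fromℤ-+ : ∀ a b → fromℤ (a ℤ.+ b) ≡ fromℤ a + fromℤ b
  fromℤ-+ a b = toℚᵘ-injective (begin
    toℚᵘ (fromℤ (a ℤ.+ b))                ≈⟨ toℚᵘ-fromℤ (a ℤ.+ b) ⟩
    ℚᵘ.mkℚᵘ (a ℤ.+ b) 0                   ≈⟨ ℚᵘ.*≡* e ⟩
    ℚᵘ.mkℚᵘ a 0 ℚᵘ.+ ℚᵘ.mkℚᵘ b 0          ≈⟨ ℚᵘ.+-cong (toℚᵘ-fromℤ a) (toℚᵘ-fromℤ b) ⟨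
    toℚᵘ (fromℤ a) ℚᵘ.+ toℚᵘ (fromℤ b)    ≈⟨ toℚᵘ-homo-+ (fromℤ a) (fromℤ b) ⟨
    toℚᵘ (fromℤ a + fromℤ b)              ∎)
    where
    e : (a ℤ.+ b) ℤ.* + 1 ≡ (a ℤ.* + 1 ℤ.+ b ℤ.* + 1) ℤ.* + 1
    e = solve (a ∷ b ∷ [])

  fromℤ-* : ∀ a b → fromℤ (a ℤ.* b) ≡ fromℤ a * fromℤ b
  fromℤ-* a b = toℚᵘ-injective (begin
    toℚᵘ (fromℤ (a ℤ.* b))                ≈⟨ toℚᵘ-fromℤ (a ℤ.* b) ⟩
    ℚᵘ.mkℚᵘ a 0 ℚᵘ.* ℚᵘ.mkℚᵘ b 0          ≈⟨ ℚᵘ.*-cong (toℚᵘ-fromℤ a) (toℚᵘ-fromℤ b) ⟨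
    toℚᵘ (fromℤ a) ℚᵘ.* toℚᵘ (fromℤ b)    ≈⟨ toℚᵘ-homo-* (fromℤ a) (fromℤ b) ⟨
    toℚᵘ (fromℤ a * fromℤ b)              ∎)

  ι-+ : ∀ m n → ι (m ℕ.+ n) ≡ ι m + ι n
  ι-+ m n = trans (cong fromℤ (ℤ.pos-+ m n)) (fromℤ-+ (+ m) (+ n))

  ι-* : ∀ m n → ι (m ℕ.* n) ≡ ι m * ι n
  ι-* m n = trans (cong fromℤ (ℤ.pos-* m n)) (fromℤ-* (+ m) (+ n))

  ι-suc : ∀ n → ι (suc n) ≡ ι n + 1ℚ
  ι-suc n = trans (cong ι (ℕ.+-comm 1 n)) (ι-+ n 1)

  1/[1+n]*[1+n]≡1 : ∀ n → (+ 1) / suc n * ι (suc n) ≡ 1ℚ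
  1/[1+n]*[1+n]≡1 n = toℚᵘ-injective (begin
    toℚᵘ ((+ 1) / suc n * ι (suc n))                ≈⟨ toℚᵘ-homo-* ((+ 1) / suc n) (ι (suc n)) ⟩
    toℚᵘ ((+ 1) / suc n) ℚᵘ.* toℚᵘ (ι (suc n))      ≈⟨ ℚᵘ.*-cong (toℚᵘ-fromℚᵘ (ℚᵘ.mkℚᵘ (+ 1) n)) (toℚᵘ-fromℤ (+ suc n)) ⟩
    x                                              ≈⟨ ℚᵘ.*≡* e ⟩
    toℚᵘ 1ℚ                                        ∎)
    where
    x = ℚᵘ.mkℚᵘ (+ 1) n ℚᵘ.* ℚᵘ.mkℚᵘ (+ suc n) 0
    e : ℚᵘ.↥ x ℤ.* ℚᵘ.↧ toℚᵘ 1ℚ ≡ ℚᵘ.↥ toℚᵘ 1ℚ ℤ.* ℚᵘ.↧ x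
    e = trans (ℤ.*-identityʳ _) (trans (ℤ.*-identityˡ _) (sym (trans (ℤ.*-identityˡ _) (cong (λ k → + suc k) (ℕ.*-identityʳ n)))))

  ↥*≡*↧ : ∀ q m z → q * fromℤ m ≡ fromℤ z → ↥ q ℤ.* m ≡ z ℤ.* ↧ q
  ↥*≡*↧ q@(mkℚ a d _) m z q*m≡z = cross-multiply (begin
    ℚᵘ.mkℚᵘ a d ℚᵘ.* ℚᵘ.mkℚᵘ m 0          ≈⟨ ℚᵘ.*-cong ℚᵘ.≃-refl (toℚᵘ-fromℤ m) ⟨
    toℚᵘ q ℚᵘ.* toℚᵘ (fromℤ m)            ≈⟨ toℚᵘ-homo-* q (fromℤ m) ⟨
    toℚᵘ (q * fromℤ m)                    ≈⟨ toℚᵘ-cong q*m≡z ⟩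
    toℚᵘ (fromℤ z)                        ≈⟨ toℚᵘ-fromℤ z ⟩
    ℚᵘ.mkℚᵘ z 0                           ∎)
    where
    cross-multiply : ℚᵘ.mkℚᵘ a d ℚᵘ.* ℚᵘ.mkℚᵘ m 0 ℚᵘ.≃ ℚᵘ.mkℚᵘ z 0 → a ℤ.* m ≡ z ℤ.* + suc d
    cross-multiply (ℚᵘ.*≡* e) = trans (sym (ℤ.*-identityʳ _)) (trans e (cong (λ k → z ℤ.* + suc k) (ℕ.*-identityʳ d)))

  -- Evaluating in ℤ and in ℚ commutes with fromℤ, which certifies that a polynomial with integer
  -- coefficients, taken at integers, is the image of an integer.
  infixl 6 _⊕_
  infixl 7 _⊗_

  data IntExpr : Set where
    ⌜_⌝     : ℤ → IntExpr
    _⊕_ _⊗_ : IntExpr → IntExpr → IntExpr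

  ⟦_⟧ℤ : IntExpr → ℤ
  ⟦ ⌜ z ⌝ ⟧ℤ  = z
  ⟦ e ⊕ f ⟧ℤ = ⟦ e ⟧ℤ ℤ.+ ⟦ f ⟧ℤ
  ⟦ e ⊗ f ⟧ℤ = ⟦ e ⟧ℤ ℤ.* ⟦ f ⟧ℤ

  ⟦_⟧ℚ : IntExpr → ℚ
  ⟦ ⌜ z ⌝ ⟧ℚ  = fromℤ z
  ⟦ e ⊕ f ⟧ℚ = ⟦ e ⟧ℚ + ⟦ f ⟧ℚ
  ⟦ e ⊗ f ⟧ℚ = ⟦ e ⟧ℚ * ⟦ f ⟧ℚ

  fromℤ-⟦⟧ : ∀ e → fromℤ ⟦ e ⟧ℤ ≡ ⟦ e ⟧ℚ
  fromℤ-⟦⟧ ⌜ z ⌝    = refl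
  fromℤ-⟦⟧ (e ⊕ f) = trans (fromℤ-+ ⟦ e ⟧ℤ ⟦ f ⟧ℤ) (cong₂ _+_ (fromℤ-⟦⟧ e) (fromℤ-⟦⟧ f))
  fromℤ-⟦⟧ (e ⊗ f) = trans (fromℤ-* ⟦ e ⟧ℤ ⟦ f ⟧ℤ) (cong₂ _*_ (fromℤ-⟦⟧ e) (fromℤ-⟦⟧ f))

-- Each polynomial is written once, over an arbitrary signature, and then read in ℚ, as syntax
-- for the ring solver, and as an IntExpr.
module Polynomials {A : Set} (plus times : A → A → A) (⌜_⌝ : ℤ → A) where
  open import Data.Integer.Base using (+_; -_)

  infixl 6 _⊞_
  infixl 7 _⊠_
  _⊞_ _⊠_ : A → A → A
  _⊞_ = plus
  _⊠_ = times

  1# : A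
  1# = ⌜ + 1 ⌝

  closedForm : A → A → A
  closedForm x h = ⌜ + 18 ⌝ ⊠ x ⊠ (x ⊞ 1#) ⊠ (⌜ + 2 ⌝ ⊠ x ⊞ 1#) ⊠ h ⊠ h
                 ⊞ (⌜ - + 18 ⌝ ⊞ ⌜ + 6 ⌝ ⊠ x ⊞ ⌜ + 18 ⌝ ⊠ x ⊠ x ⊞ ⌜ - + 24 ⌝ ⊠ x ⊠ x ⊠ x) ⊠ h
                 ⊞ (⌜ + 25 ⌝ ⊠ x ⊞ ⌜ - + 15 ⌝ ⊠ x ⊠ x ⊞ ⌜ + 8 ⌝ ⊠ x ⊠ x ⊠ x)

  closedForm-defect : A → A → A → A
  closedForm-defect x h u = ⌜ + 36 ⌝ ⊠ x ⊠ x ⊠ u ⊞ ⌜ + 18 ⌝ ⊠ x ⊠ u ⊞ ⌜ + 36 ⌝ ⊠ x ⊠ h ⊞ ⌜ + 72 ⌝ ⊠ x ⊠ x ⊠ h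
                          ⊞ ⌜ + 6 ⌝ ⊠ x ⊞ ⌜ - + 18 ⌝ ⊞ ⌜ - + 24 ⌝ ⊠ x ⊠ x

  numeratorCofactor : A → A → A → A
  numeratorCofactor x t f = ⌜ + 18 ⌝ ⊠ x ⊠ (⌜ + 2 ⌝ ⊠ x ⊞ 1#) ⊠ (x ⊞ 1#) ⊠ (x ⊞ 1#) ⊠ t ⊠ t
                          ⊞ (⌜ - + 24 ⌝ ⊠ x ⊠ x ⊞ ⌜ + 42 ⌝ ⊠ x ⊞ ⌜ - + 36 ⌝) ⊠ t ⊠ f ⊞ ⌜ + 8 ⌝ ⊠ f ⊠ f

  numeratorDefect : A → A → A → A → A
  numeratorDefect x h f t = ⌜ + 18 ⌝ ⊠ x ⊠ (x ⊞ 1#) ⊠ (⌜ + 2 ⌝ ⊠ x ⊞ 1#) ⊠ (h ⊠ f ⊞ t ⊠ ((x ⊞ 1#) ⊠ (x ⊞ 1#)))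
                          ⊞ (x ⊞ 1#) ⊠ (⌜ - + 24 ⌝ ⊠ x ⊠ x ⊞ ⌜ + 42 ⌝ ⊠ x ⊞ ⌜ - + 36 ⌝) ⊠ f

module ClosedForm where
  open import Data.Nat.Base as ℕ using (ℕ; zero; suc)
  open import Data.Integer.Base using (+_)
  open import Data.Rational.Base
  open import Data.Rational.Properties
  open import Data.Rational.Solver
  open +-*-Solver
  open import Relation.Binary.PropositionalEquality
  open ≡-Reasoning
  open IntegersInRationals
  open Polynomials _+_ _*_ fromℤ
  module Syntax {m} = Polynomials {Polynomial m} _:+_ _:*_ (λ z → con (fromℤ z))

  closedForm-step : ∀ x h u →
    closedForm (x + 1ℚ) (h + u)
      ≡ closedForm x h + fromℤ (+ 108) * ((x + 1ℚ) * (x + 1ℚ) * ((h + u) * (h + u)))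
        + closedForm-defect x h u * ((x + 1ℚ) * u - 1ℚ)
  closedForm-step = solve 3 (λ x h u →
    Syntax.closedForm (x :+ con 1ℚ) (h :+ u)
      := Syntax.closedForm x h :+ con (fromℤ (+ 108)) :* ((x :+ con 1ℚ) :* (x :+ con 1ℚ) :* ((h :+ u) :* (h :+ u)))
         :+ Syntax.closedForm-defect x h u :* ((x :+ con 1ℚ) :* u :- con 1ℚ)) refl

  numerator-identity : ∀ s x h f t →
    (s - ((- ((+ 4) / 9)) + ((+ 79) / 108) * (x + 1ℚ) - ((+ 13) / 36) * ((x + 1ℚ) * (x + 1ℚ)) + ((+ 1) / 6) * h))
      * (fromℤ (+ 108) * f * f)
      ≡ (x + 1ℚ) * (x + 1ℚ) * (x + 1ℚ) * numeratorCofactor x t f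
        + f * f * (fromℤ (+ 108) * s - closedForm x h)
        + numeratorDefect x h f t * (h * f - t * ((x + 1ℚ) * (x + 1ℚ)))
  numerator-identity = solve 5 (λ s x h f t →
    (s :- (:- con ((+ 4) / 9) :+ con ((+ 79) / 108) :* (x :+ con 1ℚ)
           :- con ((+ 13) / 36) :* ((x :+ con 1ℚ) :* (x :+ con 1ℚ)) :+ con ((+ 1) / 6) :* h))
      :* (con (fromℤ (+ 108)) :* f :* f)
      := (x :+ con 1ℚ) :* (x :+ con 1ℚ) :* (x :+ con 1ℚ) :* Syntax.numeratorCofactor x t f
         :+ f :* f :* (con (fromℤ (+ 108)) :* s :- Syntax.closedForm x h)
         :+ Syntax.numeratorDefect x h f t :* (h :* f :- t :* ((x :+ con 1ℚ) :* (x :+ con 1ℚ)))) refl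

  +-vanishing : ∀ x y {u v} → u ≡ v → x + y * (u - v) ≡ x
  +-vanishing x y {u} refl = begin
    x + y * (u - u)  ≡⟨ cong (λ z → x + y * z) (+-inverseʳ u) ⟩
    x + y * 0ℚ       ≡⟨ cong (λ z → x + z) (*-zeroʳ y) ⟩
    x + 0ℚ           ≡⟨ +-identityʳ x ⟩
    x                ∎

  108*∑k²H²≡closedForm : ∀ n → fromℤ (+ 108) * Σ₁ n (λ k → ι k * ι k * (H k * H k)) ≡ closedForm (ι n) (H n)
  108*∑k²H²≡closedForm zero    = refl
  108*∑k²H²≡closedForm (suc n) = begin
    c * (Σ₁ n f + ι (suc n) * ι (suc n) * ((h + u) * (h + u)))
      ≡⟨ *-distribˡ-+ c (Σ₁ n f) _ ⟩
    c * Σ₁ n f + c * (ι (suc n) * ι (suc n) * ((h + u) * (h + u)))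
      ≡⟨ cong₂ (λ a y → a + c * (y * y * ((h + u) * (h + u)))) (108*∑k²H²≡closedForm n) (ι-suc n) ⟩
    closedForm x h + c * ((x + 1ℚ) * (x + 1ℚ) * ((h + u) * (h + u)))
      ≡⟨ +-vanishing _ (closedForm-defect x h u) [x+1]*u≡1 ⟨
    closedForm x h + c * ((x + 1ℚ) * (x + 1ℚ) * ((h + u) * (h + u))) + closedForm-defect x h u * ((x + 1ℚ) * u - 1ℚ)
      ≡⟨ closedForm-step x h u ⟨
    closedForm (x + 1ℚ) (h + u)
      ≡⟨ cong (λ y → closedForm y (h + u)) (ι-suc n) ⟨
    closedForm (ι (suc n)) (h + u)                                                   ∎
    where
    f : ℕ → ℚ
    f k = ι k * ι k * (H k * H k)
    c = fromℤ (+ 108)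
    x = ι n
    h = H n
    u = (+ 1) / suc n
    [x+1]*u≡1 : (x + 1ℚ) * u ≡ 1ℚ
    [x+1]*u≡1 = trans (cong (_* u) (sym (ι-suc n))) (trans (*-comm (ι (suc n)) u) (1/[1+n]*[1+n]≡1 n))

module HarmonicNumerator where
  open import Data.Nat.Base as ℕ using (ℕ; zero; suc; _!)
  open import Data.Nat.Divisibility using (_∣_; ∣-refl; ∣-trans; m∣m*n; n∣m*n)
  open import Data.Nat.DivMod using (m/n*n≡m)
  open import Data.Fin.Base using (toℕ)
  open import Data.Integer.Base using (+_)
  open import Data.Rational.Base using (_/_; _+_; _*_; 1ℚ)
  open import Data.Rational.Properties using (*-zeroˡ; *-distribʳ-+; *-comm; *-assoc; *-identityˡ)
  open import Relation.Binary.PropositionalEquality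
  open ≡-Reasoning
  open FinSums using (sum-syntax; sum-toℕ-snoc)
  open IntegersInRationals
  open Wolstenholme using (harmonicNumerator)

  H*ι≡ι∑ : ∀ F m → m ! ∣ F → H m * ι F ≡ ι (∑[ i < m ] (F ℕ./ suc (toℕ i)))
  H*ι≡ι∑ F zero    _    = *-zeroˡ (ι F)
  H*ι≡ι∑ F (suc m) m!∣F = begin
    (H m + u) * ι F                    ≡⟨ *-distribʳ-+ (ι F) (H m) u ⟩
    H m * ι F + u * ι F                ≡⟨ cong₂ _+_ (H*ι≡ι∑ F m (∣-trans (n∣m*n (suc m)) m!∣F)) u*ιF≡ιq ⟩
    ι S + ι q                          ≡⟨ ι-+ S q ⟨
    ι (S ℕ.+ q)                        ≡⟨ cong ι (sum-toℕ-snoc m (λ k → F ℕ./ suc k)) ⟨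
    ι (∑[ i < suc m ] (F ℕ./ suc (toℕ i)))  ∎
    where
    u = (+ 1) / suc m
    q = F ℕ./ suc m
    S = ∑[ i < m ] (F ℕ./ suc (toℕ i))
    u*ιF≡ιq : u * ι F ≡ ι q
    u*ιF≡ιq = begin
      u * ι F                   ≡⟨ cong (λ k → u * ι k) (m/n*n≡m (∣-trans (m∣m*n (m !)) m!∣F)) ⟨
      u * ι (q ℕ.* suc m)       ≡⟨ cong (u *_) (trans (ι-* q (suc m)) (*-comm (ι q) _)) ⟩
      u * (ι (suc m) * ι q)     ≡⟨ *-assoc u _ _ ⟨
      u * ι (suc m) * ι q       ≡⟨ cong (_* ι q) (1/[1+n]*[1+n]≡1 m) ⟩
      1ℚ * ι q                  ≡⟨ *-identityˡ (ι q) ⟩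
      ι q                       ∎

  H*ι[n!]≡ι[harmonicNumerator] : ∀ n → H n * ι (n !) ≡ ι (harmonicNumerator n)
  H*ι[n!]≡ι[harmonicNumerator] n = H*ι≡ι∑ (n !) n ∣-refl

module Numerators where
  open import Data.Nat.Base as ℕ using (ℕ; _^_; _!; _≤_; _<_)
  open import Data.Nat.Divisibility using (_∣_; divides; ∣-trans; m∣m*n)
  open import Data.Nat.Primality using (Prime)
  open import Data.Nat.Tactic.RingSolver using (solve-∀)
  open import Data.Integer.Base as ℤ using (+_; ∣_∣)
  import Data.Integer.Properties as ℤ
  open import Data.Rational.Base using (↥_; ↧_; _*_)
  open import Relation.Nullary using (¬_)
  open import Relation.Binary.PropositionalEquality
  open ≡-Reasoning
  open PrimeDivisors
  open IntegersInRationals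

  numerator-divisible : ∀ {p m} → Prime p → ¬ p ∣ m → ∀ q z → q * ι m ≡ fromℤ z →
                        ∀ e → p ^ e ∣ ∣ z ∣ → p ^ e ∣ ∣ ↥ q ∣
  numerator-divisible {p} {m} p-prime p∤m q z q*m≡z e pᵉ∣z =
    ^∣-cancelʳ p-prime p∤m e (subst (p ^ e ∣_) ∣z∣*∣↧q∣≡∣↥q∣*m (∣-trans pᵉ∣z (m∣m*n ∣ ↧ q ∣)))
    where
    ∣z∣*∣↧q∣≡∣↥q∣*m : ∣ z ∣ ℕ.* ∣ ↧ q ∣ ≡ ∣ ↥ q ∣ ℕ.* m
    ∣z∣*∣↧q∣≡∣↥q∣*m = begin
      ∣ z ∣ ℕ.* ∣ ↧ q ∣     ≡⟨ ℤ.abs-* z (↧ q) ⟨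
      ∣ z ℤ.* ↧ q ∣         ≡⟨ cong ∣_∣ (↥*≡*↧ q (+ m) z q*m≡z) ⟨
      ∣ ↥ q ℤ.* + m ∣       ≡⟨ ℤ.abs-* (↥ q) (+ m) ⟩
      ∣ ↥ q ∣ ℕ.* m         ∎

  p∤108*m!*m! : ∀ {p m} → Prime p → 5 ≤ p → m < p → ¬ p ∣ 108 ℕ.* m ! ℕ.* m !
  p∤108*m!*m! p-prime 5≤p m<p = ∤-* p-prime (∤-* p-prime p∤108 (<⇒∤! p-prime m<p)) (<⇒∤! p-prime m<p)
    where
    p∤2 = ∤2 p-prime 5≤p
    p∤3 = ∤3 p-prime 5≤p
    p∤108 = ∤-* p-prime p∤2 (∤-* p-prime p∤2 (∤-* p-prime p∤3 (∤-* p-prime p∤3 p∤3)))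

  p³∣∣p*p*p*z∣ : ∀ p z → p ^ 3 ∣ ∣ + p ℤ.* + p ℤ.* + p ℤ.* z ∣
  p³∣∣p*p*p*z∣ p z = divides ∣ z ∣ (begin
    ∣ + p ℤ.* + p ℤ.* + p ℤ.* z ∣          ≡⟨ ℤ.abs-* (+ p ℤ.* + p ℤ.* + p) z ⟩
    ∣ + p ℤ.* + p ℤ.* + p ∣ ℕ.* ∣ z ∣      ≡⟨ cong (ℕ._* ∣ z ∣) (ℤ.abs-* (+ p ℤ.* + p) (+ p)) ⟩
    ∣ + p ℤ.* + p ∣ ℕ.* p ℕ.* ∣ z ∣        ≡⟨ cong (λ x → x ℕ.* p ℕ.* ∣ z ∣) (ℤ.abs-* (+ p) (+ p)) ⟩
    p ℕ.* p ℕ.* p ℕ.* ∣ z ∣                ≡⟨ cube p ∣ z ∣ ⟩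
    ∣ z ∣ ℕ.* p ^ 3                        ∎)
    where
    cube : ∀ p w → p ℕ.* p ℕ.* p ℕ.* w ≡ w ℕ.* (p ℕ.* (p ℕ.* (p ℕ.* 1)))
    cube = solve-∀

module Reduction where
  open import Data.Nat.Base as ℕ using (ℕ; suc; _^_; _!)
  import Data.Nat.Properties as ℕ
  open import Data.Nat.Divisibility using (_∣_)
  open import Data.Integer.Base using (+_; ∣_∣)
  open import Data.Rational.Base using (ℚ; _/_; _+_; _-_; _*_; -_; 1ℚ)
  open import Relation.Binary.PropositionalEquality
  open ≡-Reasoning
  open IntegersInRationals
  open Polynomials _+_ _*_ fromℤ
  open ClosedForm
  open HarmonicNumerator using (H*ι[n!]≡ι[harmonicNumerator])
  open Wolstenholme using (harmonicNumerator)
  open Numerators using (p³∣∣p*p*p*z∣)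
  module ℤ-Polynomials = Polynomials _⊕_ _⊗_ ⌜_⌝

  excess : ℕ → ℚ
  excess n = Σ₁ n (λ k → ι k * ι k * (H k * H k))
    - ((- ((+ 4) / 9)) + ((+ 79) / 108) * ι (suc n) - ((+ 13) / 36) * (ι (suc n) * ι (suc n)) + ((+ 1) / 6) * H n)

  cofactor : ℕ → ℕ → IntExpr
  cofactor n t = ℤ-Polynomials.numeratorCofactor ⌜ + n ⌝ ⌜ + t ⌝ ⌜ + (n !) ⌝

  cubedCofactor : ℕ → ℕ → IntExpr
  cubedCofactor n t = ⌜ + suc n ⌝ ⊗ ⌜ + suc n ⌝ ⊗ ⌜ + suc n ⌝ ⊗ cofactor n t

  p³∣cubedCofactor : ∀ n t → suc n ^ 3 ∣ ∣ ⟦ cubedCofactor n t ⟧ℤ ∣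
  p³∣cubedCofactor n t = p³∣∣p*p*p*z∣ (suc n) ⟦ cofactor n t ⟧ℤ

  excess*108[n!]²≡cubedCofactor : ∀ n t → harmonicNumerator n ≡ t ℕ.* suc n ^ 2 →
                                  excess n * ι (108 ℕ.* n ! ℕ.* n !) ≡ fromℤ ⟦ cubedCofactor n t ⟧ℤ
  excess*108[n!]²≡cubedCofactor n t N≡tp² = begin
    (s - target (ι (suc n))) * ι (108 ℕ.* n ! ℕ.* n !)
      ≡⟨ cong₂ (λ y z → (s - target y) * z) (ι-suc n) (trans (ι-* (108 ℕ.* n !) (n !)) (cong (_* f) (ι-* 108 (n !)))) ⟩
    (s - target (x + 1ℚ)) * (fromℤ (+ 108) * f * f)
      ≡⟨ numerator-identity s x h f τ ⟩
    P³G + f * f * (fromℤ (+ 108) * s - closedForm x h) + numeratorDefect x h f τ * (h * f - τ * ((x + 1ℚ) * (x + 1ℚ)))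
      ≡⟨ +-vanishing _ (numeratorDefect x h f τ) hf≡τ[x+1]² ⟩
    P³G + f * f * (fromℤ (+ 108) * s - closedForm x h)
      ≡⟨ +-vanishing P³G (f * f) (108*∑k²H²≡closedForm n) ⟩
    P³G
      ≡⟨ cong (λ y → y * y * y * numeratorCofactor x τ f) (ι-suc n) ⟨
    ⟦ cubedCofactor n t ⟧ℚ
      ≡⟨ fromℤ-⟦⟧ (cubedCofactor n t) ⟨
    fromℤ ⟦ cubedCofactor n t ⟧ℤ                                                   ∎
    where
    s = Σ₁ n (λ k → ι k * ι k * (H k * H k))
    x = ι n
    h = H n
    f = ι (n !)
    τ = ι t
    target : ℚ → ℚ
    target y = (- ((+ 4) / 9)) + ((+ 79) / 108) * y - ((+ 13) / 36) * (y * y) + ((+ 1) / 6) * h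
    P³G = (x + 1ℚ) * (x + 1ℚ) * (x + 1ℚ) * numeratorCofactor x τ f
    hf≡τ[x+1]² : h * f ≡ τ * ((x + 1ℚ) * (x + 1ℚ))
    hf≡τ[x+1]² = begin
      h * f                               ≡⟨ H*ι[n!]≡ι[harmonicNumerator] n ⟩
      ι (harmonicNumerator n)             ≡⟨ cong ι N≡tp² ⟩
      ι (t ℕ.* suc n ^ 2)                 ≡⟨ ι-* t (suc n ^ 2) ⟩
      τ * ι (suc n ℕ.* (suc n ℕ.* 1))     ≡⟨ cong (λ k → τ * ι (suc n ℕ.* k)) (ℕ.*-identityʳ (suc n)) ⟩
      τ * ι (suc n ℕ.* suc n)             ≡⟨ cong (τ *_) (ι-* (suc n) (suc n)) ⟩
      τ * (ι (suc n) * ι (suc n))         ≡⟨ cong (λ y → τ * (y * y)) (ι-suc n) ⟩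
      τ * ((x + 1ℚ) * (x + 1ℚ))           ∎

open import Data.Nat using (ℕ; suc; _≥_; _∸_; _^_)
open import Data.Nat.Properties using (n<1+n)
open import Data.Nat.Divisibility using (_∣_)
open import Data.Nat.Primality using (Prime)
open import Data.Integer using (+_)
open import Data.Rational using (_/_; _+_; _-_; _*_; -_)
open IntegersInRationals using (⟦_⟧ℤ)
open Wolstenholme using (wolstenholme)
open Numerators using (numerator-divisible; p∤108*m!*m!)
open Reduction using (excess; cubedCofactor; p³∣cubedCofactor; excess*108[n!]²≡cubedCofactor)

mainTheorem6 : (p : ℕ) → Prime p → p ≥ 5 →
    Σ₁ (p ∸ 1) (λ k → ι k * ι k * (H k * H k))
    ≡ (- ((+ 4) / 9)) + ((+ 79) / 108) * ι p - ((+ 13) / 36) * (ι p * ι p) + ((+ 1) / 6) * H (p ∸ 1)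
    [modℚ p ^ 3 ]
mainTheorem6 (suc n) p-prime 5≤p =
  numerator-divisible p-prime (p∤108*m!*m! p-prime 5≤p (n<1+n n)) (excess n) ⟦ cubedCofactor n t ⟧ℤ
    (excess*108[n!]²≡cubedCofactor n t N≡tp²) 3 (p³∣cubedCofactor n t)
  where
  open _∣_ (wolstenholme n p-prime 5≤p) renaming (quotient to t; equality to N≡tp²)
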